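{- Let $N\in\mathbb{N}$. Then \begin{equation*} \sum_{n=1}^{N}\frac{q^n(q^{n+1};q)_{N-n}}{(q^{2n};q^2)_{N-n+1}}=\sum_{n=1}^{\infty}N_{\mathrm{SC}}(n, N)q^n. \end{equation*}
   Context: $(A;p)_0=1$, $(A;p)_n=(1-A)(1-Ap)\cdots(1-Ap^{n-1})$. For a partition $\pi$, $|\pi|$, $s(\pi)$, $l(\pi)$, $\#(\pi)$ denote its sum, smallest part, largest part and number of parts. Let $S_N$ be the set of triples $\vec\pi=(\pi_1,\pi_2,\pi_3)$ with $\pi_1$ a nonempty partition into distinct parts, $\pi_2,\pi_3$ arbitrary partitions, $s(\pi_1)\leq\min(s(\pi_2),s(\pi_3))$ (with $s$ of the empty partition taken as $\infty$), and $l(\pi_1),l(\pi_2),l(\pi_3)\leq N$; $|\vec\pi|=|\pi_1|+|\pi_2|+|\pi_3|$. A triple is self-conjugate if $\pi_2=\pi_3$. $N_{\mathrm{SC}}(n,N)$ is the sum of $(-1)^{\#(\pi_1)-1}$ over self-conjugate $\vec\pi\in S_N$ with $|\vec\pi|=n$. -}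

module Defs where

open import Data.Nat as ℕ using (ℕ; zero; suc; _≤ᵇ_; _∸_)
open import Data.Integer as ℤ using (ℤ; +_; -_; -1ℤ; 0ℤ; 1ℤ)
open import Data.Bool using (Bool; true; false; _∧_; if_then_else_)
open import Data.Maybe using (Maybe; just; nothing)
open import Data.List as L using (List; []; _∷_; upTo; map; zipWith; concatMap; foldr)
open import Data.Vec as V using (Vec; []; _∷_)

-- Formal power series in q with integer coefficients: n ↦ [q^n]

PS : Set
PS = ℕ → ℤ

sumℤ : List ℤ → ℤ
sumℤ = foldr ℤ._+_ 0ℤ

-- Σ_{i=a}^{b} f i  (integers), empty if b < a
Σℤ[_to_] : ℕ → ℕ → (ℕ → ℤ) → ℤ
Σℤ[ a to b ] f = sumℤ (map (λ i → f (a ℕ.+ i)) (upTo (suc b ∸ a)))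

constPS : ℤ → PS
constPS c zero    = c
constPS c (suc n) = 0ℤ

oneP : PS
oneP = constPS 1ℤ

qpow : ℕ → PS
qpow k n = if k ℕ.≡ᵇ n then 1ℤ else 0ℤ

_+P_ : PS → PS → PS
(a +P b) n = a n ℤ.+ b n

_-P_ : PS → PS → PS
(a -P b) n = a n ℤ.- b n

_*P_ : PS → PS → PS
(a *P b) n = sumℤ (map (λ i → a i ℤ.* b (n ∸ i)) (upTo (suc n)))

powP : PS → ℕ → PS
powP a zero    = oneP
powP a (suc j) = a *P powP a j

prodP : ℕ → (ℕ → PS) → PS
prodP zero    f = oneP
prodP (suc n) f = prodP n f *P f n

sumP[_to_] : ℕ → ℕ → (ℕ → PS) → PS
sumP[ a to b ] f n = Σℤ[ a to b ] (λ j → f j n)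

poch : PS → PS → ℕ → PS
poch A p n = prodP n (λ j → oneP -P (A *P powP p j))

-- Multiplicative inverse of a power series with constant term 1:
-- b_0 = 1, b_m = - Σ_{j=1}^{m} a_j b_{m-j}.
-- invRev a m = [b_m , b_{m-1} , ... , b_0]
invRev : PS → ℕ → List ℤ
invRev a zero    = 1ℤ ∷ []
invRev a (suc m) =
  let bs = invRev a m in
  (ℤ.- sumℤ (zipWith ℤ._*_ (map (λ i → a (suc i)) (upTo (suc m))) bs)) ∷ bs

headℤ : List ℤ → ℤ
headℤ []      = 0ℤ
headℤ (x ∷ _) = x

invP : PS → PS
invP a m = headℤ (invRev a m)

lhs : ℕ → PS
lhs N = sumP[ 1 to N ] (λ n →
          (qpow n *P poch (qpow (suc n)) (qpow 1) (N ∸ n))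
            *P invP (poch (qpow (2 ℕ.* n)) (qpow 2) (suc (N ∸ n))))

-- Partitions with largest part ≤ N, represented by multiplicity vectors:
-- the i-th entry (i = 0..N-1) is the multiplicity of the part i+1.

Mult : ℕ → Set
Mult N = Vec ℕ N

sizeFrom : ∀ {N} → ℕ → Mult N → ℕ
sizeFrom k []       = 0
sizeFrom k (m ∷ ms) = k ℕ.* m ℕ.+ sizeFrom (suc k) ms

size : ∀ {N} → Mult N → ℕ
size = sizeFrom 1

nparts : ∀ {N} → Mult N → ℕ
nparts = V.sum

-- s(π) : smallest part, nothing = ∞ for the empty partition
smallestFrom : ∀ {N} → ℕ → Mult N → Maybe ℕ
smallestFrom k []       = nothing
smallestFrom k (zero  ∷ ms) = smallestFrom (suc k) ms
smallestFrom k (suc _ ∷ ms) = just k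

smallest : ∀ {N} → Mult N → Maybe ℕ
smallest = smallestFrom 1

_≤∞_ : Maybe ℕ → Maybe ℕ → Bool
just a  ≤∞ just b  = a ≤ᵇ b
just a  ≤∞ nothing = true
nothing ≤∞ just b  = false
nothing ≤∞ nothing = true

min∞ : Maybe ℕ → Maybe ℕ → Maybe ℕ
min∞ (just a) (just b) = just (ℕ._⊓_ a b)
min∞ (just a) nothing  = just a
min∞ nothing  y        = y

isDistinct : ∀ {N} → Mult N → Bool
isDistinct m = V.foldr _ (λ x b → (x ≤ᵇ 1) ∧ b) true m

isNonempty : ∀ {N} → Mult N → Bool
isNonempty m = 1 ≤ᵇ nparts m

-- membership of (π₁,π₂,π₃) in S_N (largest parts ≤ N built into Mult N)
inS : ∀ {N} → Mult N → Mult N → Mult N → Bool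
inS p1 p2 p3 = isDistinct p1 ∧ isNonempty p1
             ∧ (smallest p1 ≤∞ min∞ (smallest p2) (smallest p3))

tripleSize : ∀ {N} → Mult N → Mult N → Mult N → ℕ
tripleSize p1 p2 p3 = size p1 ℕ.+ size p2 ℕ.+ size p3

vecsUpTo : ℕ → (N : ℕ) → List (Vec ℕ N)
vecsUpTo b zero    = [] ∷ []
vecsUpTo b (suc N) = concatMap (λ x → map (x ∷_) (vecsUpTo b N)) (upTo (suc b))

sgn : ℕ → ℤ
sgn zero    = 1ℤ
sgn (suc k) = ℤ.- sgn k

-- Multiplicities of a partition of size ≤ n are ≤ n,
-- so enumerating multiplicity vectors with entries in {0..n} is exhaustive.
NSC : ℕ → ℕ → ℤ
NSC n N =
  sumℤ (concatMap (λ p1 → map (λ p2 →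
      if inS p1 p2 p2 ∧ (tripleSize p1 p2 p2 ℕ.≡ᵇ n)
      then sgn (nparts p1 ∸ 1) else 0ℤ)
    (vecsUpTo n N)) (vecsUpTo n N))

rhs : ℕ → PS
rhs N zero    = 0ℤ
rhs N (suc n) = NSC (suc n) N

module Submission where

-- Sort the self-conjugate triples (π₁,π₂,π₂) ∈ S_N by the smallest
-- part k of π₁.  Such a triple is π₁ = {k} ∪ π₁' with π₁' a partition into
-- distinct parts from k+1..N, together with an arbitrary partition π₂ with
-- parts from k..N, which is counted twice.  Signed distinct-part partitions
-- with parts in s..s+L-1 have generating function (q^s;q)_L, and "doubled"
-- partitions with parts in s..s+L-1 have generating function 1/(q^{2s};q^2)_L;
-- hence the triples with smallest part k contribute exactly the k-th summand
-- of the left-hand side.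
--
-- The coefficients are computed by enumerating multiplicity vectors with
-- entries ≤ b, which is exact in degrees ≤ b.

open import Defs
open import Data.Nat using (ℕ)
open import Relation.Binary.PropositionalEquality using (_≡_)
open import Data.Nat using (zero; suc; _+_; _*_; _≤_; _<_; z≤n; s≤s; _≤ᵇ_; _∸_; _≡ᵇ_)
import Data.Nat.Properties as ℕP
import Data.Nat.Tactic.RingSolver as ℕSolver
open import Data.Integer using (ℤ; 0ℤ; 1ℤ; -_) renaming (_+_ to _⊕_; _*_ to _⊛_; _-_ to _⊖_)
import Data.Integer.Properties as ℤP
open import Data.Integer.Tactic.RingSolver using (solve-∀)
open import Data.Bool using (Bool; true; false; T; _∧_; if_then_else_)
import Data.Bool.Properties as BoolP
open import Data.Maybe using (just)
open import Data.Unit using (tt)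
open import Data.List using (List; []; _∷_; map; upTo; concatMap; zipWith; _++_)
import Data.List.Properties as ListP
open import Data.Vec using (Vec; []; _∷_)
open import Data.Empty using (⊥-elim)
open import Data.Sum using (_⊎_; inj₁; inj₂)
open import Function using (_∘_)
open import Function.Bundles using (Equivalence)
open import Level using (0ℓ)
open import Relation.Binary.Bundles using (Setoid)
open import Relation.Binary.PropositionalEquality using (_≢_; refl; sym; trans; cong; cong₂; subst; module ≡-Reasoning)
open import Relation.Nullary using (Dec; yes; no)
import Relation.Binary.Reasoning.Setoid as SetoidReasoning

sumOver : ∀ {A : Set} → List A → (A → ℤ) → ℤ
sumOver L f = sumℤ (map f L)

sumOver-cong : ∀ {A : Set} (L : List A) {f g : A → ℤ} → (∀ x → f x ≡ g x) → sumOver L f ≡ sumOver L g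
sumOver-cong L f≗g = cong sumℤ (ListP.map-cong f≗g L)

sumOver-++ : ∀ {A : Set} (L M : List A) (f : A → ℤ) → sumOver (L ++ M) f ≡ sumOver L f ⊕ sumOver M f
sumOver-++ []      M f = sym (ℤP.+-identityˡ _)
sumOver-++ (x ∷ L) M f = trans (cong (f x ⊕_) (sumOver-++ L M f)) (sym (ℤP.+-assoc (f x) _ _))

sumOver-concatMap : ∀ {A B : Set} (L : List A) (h : A → List B) (f : B → ℤ) →
  sumOver (concatMap h L) f ≡ sumOver L (λ x → sumOver (h x) f)
sumOver-concatMap []      h f = refl
sumOver-concatMap (x ∷ L) h f =
  trans (sumOver-++ (h x) (concatMap h L) f) (cong (sumOver (h x) f ⊕_) (sumOver-concatMap L h f))

sumOver-map : ∀ {A B : Set} (L : List A) (h : A → B) (f : B → ℤ) → sumOver (map h L) f ≡ sumOver L (f ∘ h)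
sumOver-map L h f = cong sumℤ (sym (ListP.map-∘ L))

sumOver-+ : ∀ {A : Set} (L : List A) (f g : A → ℤ) → sumOver L (λ x → f x ⊕ g x) ≡ sumOver L f ⊕ sumOver L g
sumOver-+ []      f g = refl
sumOver-+ (x ∷ L) f g =
  trans (cong ((f x ⊕ g x) ⊕_) (sumOver-+ L f g)) (interchange (f x) (g x) (sumOver L f) (sumOver L g))
  where
  interchange : ∀ a b c d → (a ⊕ b) ⊕ (c ⊕ d) ≡ (a ⊕ c) ⊕ (b ⊕ d)
  interchange = solve-∀

sumOver-zero : ∀ {A : Set} (L : List A) {f : A → ℤ} → (∀ x → f x ≡ 0ℤ) → sumOver L f ≡ 0ℤ
sumOver-zero []      f≗0 = refl
sumOver-zero (x ∷ L) f≗0 = cong₂ _⊕_ (f≗0 x) (sumOver-zero L f≗0)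

sumOver-neg : ∀ {A : Set} (L : List A) (f : A → ℤ) → sumOver L (λ x → - f x) ≡ - sumOver L f
sumOver-neg []      f = refl
sumOver-neg (x ∷ L) f = trans (cong (- f x ⊕_) (sumOver-neg L f)) (sym (ℤP.neg-distrib-+ (f x) (sumOver L f)))

sumOver-*ˡ : ∀ {A : Set} (L : List A) (c : ℤ) (f : A → ℤ) → c ⊛ sumOver L f ≡ sumOver L (λ x → c ⊛ f x)
sumOver-*ˡ []      c f = ℤP.*-zeroʳ c
sumOver-*ˡ (x ∷ L) c f = trans (ℤP.*-distribˡ-+ c (f x) (sumOver L f)) (cong (c ⊛ f x ⊕_) (sumOver-*ˡ L c f))

sumOver-*ʳ : ∀ {A : Set} (L : List A) (c : ℤ) (f : A → ℤ) → sumOver L f ⊛ c ≡ sumOver L (λ x → f x ⊛ c)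
sumOver-*ʳ []      c f = ℤP.*-zeroˡ c
sumOver-*ʳ (x ∷ L) c f = trans (ℤP.*-distribʳ-+ c (f x) (sumOver L f)) (cong (f x ⊛ c ⊕_) (sumOver-*ʳ L c f))

sumOver-swap : ∀ {A B : Set} (L : List A) (M : List B) (f : A → B → ℤ) →
  sumOver L (λ x → sumOver M (f x)) ≡ sumOver M (λ y → sumOver L (λ x → f x y))
sumOver-swap []      M f = sym (sumOver-zero M (λ _ → refl))
sumOver-swap (x ∷ L) M f =
  trans (cong (sumOver M (f x) ⊕_) (sumOver-swap L M f)) (sym (sumOver-+ M (f x) (λ y → sumOver L (λ x → f x y))))

sum-upTo-suc : ∀ n (f : ℕ → ℤ) → sumOver (upTo (suc n)) f ≡ f 0 ⊕ sumOver (upTo n) (f ∘ suc)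
sum-upTo-suc n f =
  cong (λ L → f 0 ⊕ sumℤ L) (trans (ListP.map-applyUpTo suc f n) (sym (ListP.map-upTo (f ∘ suc) n)))

sum-upTo-cong : ∀ n {f g : ℕ → ℤ} → (∀ i → i < n → f i ≡ g i) → sumOver (upTo n) f ≡ sumOver (upTo n) g
sum-upTo-cong zero    f≗g = refl
sum-upTo-cong (suc n) {f} {g} f≗g =
  trans (sum-upTo-suc n f)
    (trans (cong₂ _⊕_ (f≗g 0 (s≤s z≤n)) (sum-upTo-cong n (λ i i<n → f≗g (suc i) (s≤s i<n))))
           (sym (sum-upTo-suc n g)))

sum-upTo-zero : ∀ n (f : ℕ → ℤ) → (∀ i → i < n → f i ≡ 0ℤ) → sumOver (upTo n) f ≡ 0ℤ
sum-upTo-zero n f f≗0 = trans (sum-upTo-cong n f≗0) (sumOver-zero (upTo n) (λ _ → refl))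

sum-upTo-single : ∀ n (f : ℕ → ℤ) a → a < n → (∀ i → i < n → i ≢ a → f i ≡ 0ℤ) →
  sumOver (upTo n) f ≡ f a
sum-upTo-single (suc n) f zero    _ f≗0 =
  trans (sum-upTo-suc n f)
    (trans (cong (f 0 ⊕_) (sum-upTo-zero n (f ∘ suc) (λ i i<n → f≗0 (suc i) (s≤s i<n) (λ ()))))
           (ℤP.+-identityʳ (f 0)))
sum-upTo-single (suc n) f (suc a) (s≤s a<n) f≗0 =
  trans (sum-upTo-suc n f)
    (trans (cong₂ _⊕_ (f≗0 0 (s≤s z≤n) (λ ()))
                      (sum-upTo-single n (f ∘ suc) a a<n
                         (λ i i<n i≢a → f≗0 (suc i) (s≤s i<n) (i≢a ∘ ℕP.suc-injective))))
           (ℤP.+-identityˡ _))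

sum-upTo-telescope : ∀ n (f : ℕ → ℤ) → sumOver (upTo n) (λ y → f y ⊖ f (suc y)) ≡ f 0 ⊖ f n
sum-upTo-telescope zero    f = sym (ℤP.+-inverseʳ (f 0))
sum-upTo-telescope (suc n) f =
  trans (sum-upTo-suc n (λ y → f y ⊖ f (suc y)))
    (trans (cong ((f 0 ⊖ f 1) ⊕_) (sum-upTo-telescope n (f ∘ suc))) (cancel (f 0) (f 1) (f (suc n))))
  where
  cancel : ∀ a b c → (a ⊖ b) ⊕ (b ⊖ c) ≡ a ⊖ c
  cancel = solve-∀

infix 4 _≈_ _≈[_]_

_≈_ : PS → PS → Set
a ≈ b = ∀ n → a n ≡ b n

_≈[_]_ : PS → ℕ → PS → Set
a ≈[ m ] b = ∀ n → n ≤ m → a n ≡ b n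

PS-setoid : Setoid 0ℓ 0ℓ
PS-setoid = record
  { Carrier       = PS
  ; _≈_           = _≈_
  ; isEquivalence = record { refl = λ _ → refl ; sym = λ e n → sym (e n) ; trans = λ e f n → trans (e n) (f n) }
  }

module ≈-Reasoning = SetoidReasoning PS-setoid
open Setoid PS-setoid using () renaming (refl to ≈-refl; sym to ≈-sym; trans to ≈-trans)

≈⇒≈[] : ∀ {a b m} → a ≈ b → a ≈[ m ] b
≈⇒≈[] e n _ = e n

≈[]-sym : ∀ {a b m} → a ≈[ m ] b → b ≈[ m ] a
≈[]-sym e n n≤m = sym (e n n≤m)

≈[]-trans : ∀ {a b c m} → a ≈[ m ] b → b ≈[ m ] c → a ≈[ m ] c
≈[]-trans e f n n≤m = trans (e n n≤m) (f n n≤m)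

zeroP : PS
zeroP _ = 0ℤ

oneMinus : ℕ → PS
oneMinus e = oneP -P qpow e

oneMinus-cong : ∀ {e e'} → e ≡ e' → oneMinus e ≈ oneMinus e'
oneMinus-cong refl = ≈-refl

-- The monomial c q^a; qpow a is mono 1ℤ a by definition.
mono : ℤ → ℕ → PS
mono c a n = if a ≡ᵇ n then c else 0ℤ

mono-hit : ∀ c a → mono c a a ≡ c
mono-hit c zero    = refl
mono-hit c (suc a) = mono-hit c a

mono-miss : ∀ c a n → a ≢ n → mono c a n ≡ 0ℤ
mono-miss c zero    zero    a≢n = ⊥-elim (a≢n refl)
mono-miss c zero    (suc n) _   = refl
mono-miss c (suc a) zero    _   = refl
mono-miss c (suc a) (suc n) a≢n = mono-miss c a n (a≢n ∘ cong suc)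

negP : PS → PS
negP a n = - a n

negP-cong : ∀ {a b} → a ≈ b → negP a ≈ negP b
negP-cong e n = cong -_ (e n)

mono-neg : ∀ c a → mono (- c) a ≈ negP (mono c a)
mono-neg c a n with a ≡ᵇ n
... | true  = refl
... | false = refl

mono-cong : ∀ {c c' a a'} → c ≡ c' → a ≡ a' → mono c a ≈ mono c' a'
mono-cong refl refl _ = refl

oneP≈mono : oneP ≈ mono 1ℤ 0
oneP≈mono zero    = refl
oneP≈mono (suc n) = refl

-- Congruences.  The n-th coefficient of a product only involves coefficients of degree ≤ n.
*P-cong≤ : ∀ {m a a' b b'} → a ≈[ m ] a' → b ≈[ m ] b' → (a *P b) ≈[ m ] (a' *P b')
*P-cong≤ ea eb n n≤m =
  sum-upTo-cong (suc n) (λ i i≤n → cong₂ _⊛_ (ea i (ℕP.≤-trans (ℕP.≤-pred i≤n) n≤m))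
                                            (eb (n ∸ i) (ℕP.≤-trans (ℕP.m∸n≤m n i) n≤m)))

*P-cong : ∀ {a a' b b'} → a ≈ a' → b ≈ b' → (a *P b) ≈ (a' *P b')
*P-cong ea eb n = *P-cong≤ (≈⇒≈[] ea) (≈⇒≈[] eb) n ℕP.≤-refl

-P-cong : ∀ {a a' b b'} → a ≈ a' → b ≈ b' → (a -P b) ≈ (a' -P b')
-P-cong ea eb n = cong₂ _⊖_ (ea n) (eb n)

-- c q^a · d q^b = cd q^{a+b}: only the index i = a of the Cauchy sum can contribute.
mono-mul : ∀ c d a b → (mono c a *P mono d b) ≈ mono (c ⊛ d) (a + b)
mono-mul c d a b n = byPosition (ℕP.≤-<-connex a n)
  where
  term : ℕ → ℤ
  term i = mono c a i ⊛ mono d b (n ∸ i)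

  vanish : ∀ i → a ≢ i → term i ≡ 0ℤ
  vanish i a≢i = trans (cong (_⊛ mono d b (n ∸ i)) (mono-miss c a i a≢i)) (ℤP.*-zeroˡ (mono d b (n ∸ i)))

  second : Dec (b ≡ n ∸ a) → a ≤ n → c ⊛ mono d b (n ∸ a) ≡ mono (c ⊛ d) (a + b) n
  second (yes refl) a≤n =
    trans (cong (c ⊛_) (mono-hit d (n ∸ a)))
          (sym (subst (λ k → mono (c ⊛ d) k n ≡ c ⊛ d) (sym (ℕP.m+[n∸m]≡n a≤n)) (mono-hit (c ⊛ d) n)))
  second (no b≢n∸a) _ =
    trans (cong (c ⊛_) (mono-miss d b (n ∸ a) b≢n∸a))
          (trans (ℤP.*-zeroʳ c)
                 (sym (mono-miss (c ⊛ d) (a + b) n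
                        (λ a+b≡n → b≢n∸a (trans (sym (ℕP.m+n∸m≡n a b)) (cong (_∸ a) a+b≡n))))))

  byPosition : (a ≤ n) ⊎ (n < a) → sumOver (upTo (suc n)) term ≡ mono (c ⊛ d) (a + b) n
  byPosition (inj₁ a≤n) =
    trans (sum-upTo-single (suc n) term a (s≤s a≤n) (λ i _ i≢a → vanish i (i≢a ∘ sym)))
          (trans (cong (_⊛ mono d b (n ∸ a)) (mono-hit c a)) (second (b ℕP.≟ n ∸ a) a≤n))
  byPosition (inj₂ n<a) =
    trans (sum-upTo-zero (suc n) term
             (λ i i≤n → vanish i (λ a≡i → ℕP.<-irrefl (sym a≡i) (ℕP.≤-<-trans (ℕP.≤-pred i≤n) n<a))))
          (sym (mono-miss (c ⊛ d) (a + b) n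
                 (λ a+b≡n → ℕP.<-irrefl (sym a+b≡n) (ℕP.<-≤-trans n<a (ℕP.m≤m+n a b)))))

ΣP : ∀ {A : Set} → List A → (A → PS) → PS
ΣP L F n = sumOver L (λ x → F x n)

ΣP-cong : ∀ {A : Set} (L : List A) {F G : A → PS} → (∀ x → F x ≈ G x) → ΣP L F ≈ ΣP L G
ΣP-cong L F≈G n = sumOver-cong L (λ x → F≈G x n)

ΣP-zero : ∀ {A : Set} (L : List A) {F : A → PS} → (∀ x → F x ≈ zeroP) → ΣP L F ≈ zeroP
ΣP-zero L F≈0 n = sumOver-zero L (λ x → F≈0 x n)

ΣP-swap : ∀ {A B : Set} (L : List A) (M : List B) (F : A → B → PS) →
  ΣP L (λ x → ΣP M (F x)) ≈ ΣP M (λ y → ΣP L (λ x → F x y))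
ΣP-swap L M F n = sumOver-swap L M (λ x y → F x y n)

*P-distribʳ-ΣP : ∀ {A : Set} (L : List A) (F : A → PS) (G : PS) → (ΣP L F *P G) ≈ ΣP L (λ x → F x *P G)
*P-distribʳ-ΣP L F G n =
  trans (sumOver-cong (upTo (suc n)) (λ i → sumOver-*ʳ L (G (n ∸ i)) (λ x → F x i)))
        (sumOver-swap (upTo (suc n)) L (λ i x → F x i ⊛ G (n ∸ i)))

*P-distribˡ-ΣP : ∀ {A : Set} (L : List A) (F : A → PS) (G : PS) → (G *P ΣP L F) ≈ ΣP L (λ x → G *P F x)
*P-distribˡ-ΣP L F G n =
  trans (sumOver-cong (upTo (suc n)) (λ i → sumOver-*ˡ L (G i) (λ x → F x (n ∸ i))))
        (sumOver-swap (upTo (suc n)) L (λ i x → G i ⊛ F x (n ∸ i)))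

*P-zeroʳ : ∀ a → (a *P zeroP) ≈ zeroP
*P-zeroʳ a n = sumOver-zero (upTo (suc n)) (λ i → ℤP.*-zeroʳ (a i))

*P-identityˡ : ∀ a → (oneP *P a) ≈ a
*P-identityˡ a n =
  trans (sum-upTo-single (suc n) (λ i → oneP i ⊛ a (n ∸ i)) 0 (s≤s z≤n) vanish) (ℤP.*-identityˡ (a n))
  where
  vanish : ∀ i → i < suc n → i ≢ 0 → oneP i ⊛ a (n ∸ i) ≡ 0ℤ
  vanish zero    _ i≢0 = ⊥-elim (i≢0 refl)
  vanish (suc i) _ _   = ℤP.*-zeroˡ (a (n ∸ suc i))

*P-distrib-P : ∀ a b c → (a *P (b -P c)) ≈ ((a *P b) -P (a *P c))
*P-distrib-P a b c n =
  trans (sumOver-cong (upTo (suc n)) (λ i → distrib (a i) (b (n ∸ i)) (c (n ∸ i))))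
    (trans (sumOver-+ (upTo (suc n)) (λ i → a i ⊛ b (n ∸ i)) (λ i → - (a i ⊛ c (n ∸ i))))
           (cong ((a *P b) n ⊕_) (sumOver-neg (upTo (suc n)) (λ i → a i ⊛ c (n ∸ i)))))
  where
  distrib : ∀ x y z → x ⊛ (y ⊖ z) ≡ x ⊛ y ⊕ - (x ⊛ z)
  distrib = solve-∀

mono-*-monoSum : ∀ {A : Set} (L : List A) c a (f : A → ℤ) (e : A → ℕ) →
  (mono c a *P ΣP L (λ x → mono (f x) (e x))) ≈ ΣP L (λ x → mono (c ⊛ f x) (a + e x))
mono-*-monoSum L c a f e =
  ≈-trans (*P-distribˡ-ΣP L (λ x → mono (f x) (e x)) (mono c a)) (ΣP-cong L (λ x → mono-mul c (f x) a (e x)))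

monoSum-*-monoSum : ∀ {A B : Set} (L : List A) (M : List B)
  (f : A → ℤ) (e : A → ℕ) (g : B → ℤ) (h : B → ℕ) →
  (ΣP L (λ x → mono (f x) (e x)) *P ΣP M (λ y → mono (g y) (h y)))
    ≈ ΣP L (λ x → ΣP M (λ y → mono (f x ⊛ g y) (e x + h y)))
monoSum-*-monoSum L M f e g h =
  ≈-trans (*P-distribʳ-ΣP L (λ x → mono (f x) (e x)) (ΣP M (λ y → mono (g y) (h y))))
          (ΣP-cong L (λ x → mono-*-monoSum M (f x) (e x) g h))

truncate : ℕ → PS → PS
truncate m a = ΣP (upTo (suc m)) (λ i → mono (a i) i)

truncate-≈ : ∀ m a → a ≈[ m ] truncate m a
truncate-≈ m a n n≤m =
  sym (trans (sum-upTo-single (suc m) (λ i → mono (a i) i n) n (s≤s n≤m)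
                              (λ i _ i≢n → mono-miss (a i) i n i≢n))
             (mono-hit (a n) n))

-- Up to degree m, a·b is Σ_{i,j ≤ m} a_i b_j q^{i+j}; commutativity and
-- associativity are read off such expansions.
*P-expand : ∀ m a b → (a *P b) ≈[ m ]
  ΣP (upTo (suc m)) (λ i → ΣP (upTo (suc m)) (λ j → mono (a i ⊛ b j) (i + j)))
*P-expand m a b =
  ≈[]-trans (*P-cong≤ (truncate-≈ m a) (truncate-≈ m b))
            (≈⇒≈[] (monoSum-*-monoSum (upTo (suc m)) (upTo (suc m)) a (λ i → i) b (λ j → j)))

*P-comm : ∀ a b → (a *P b) ≈ (b *P a)
*P-comm a b n =
  trans (*P-expand n a b n ℕP.≤-refl)
    (trans (ΣP-swap U U (λ i j → mono (a i ⊛ b j) (i + j)) n)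
      (trans (ΣP-cong U (λ j → ΣP-cong U (λ i → mono-cong (ℤP.*-comm (a i) (b j)) (ℕP.+-comm i j))) n)
             (sym (*P-expand n b a n ℕP.≤-refl))))
  where U = upTo (suc n)

*P-identityʳ : ∀ a → (a *P oneP) ≈ a
*P-identityʳ a = ≈-trans (*P-comm a oneP) (*P-identityˡ a)

*P-zeroˡ : ∀ a → (zeroP *P a) ≈ zeroP
*P-zeroˡ a = ≈-trans (*P-comm zeroP a) (*P-zeroʳ a)

-- Both bracketings expand to the same triple sum up to degree n.
*P-assoc : ∀ a b c → ((a *P b) *P c) ≈ (a *P (b *P c))
*P-assoc a b c n = trans (left n ℕP.≤-refl) (sym (right n ℕP.≤-refl))
  where
  U = upTo (suc n)

  expansion : PS
  expansion = ΣP U (λ i → ΣP U (λ j → ΣP U (λ k → mono (a i ⊛ b j ⊛ c k) (i + j + k))))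

  left : ((a *P b) *P c) ≈[ n ] expansion
  left = ≈[]-trans (*P-cong≤ (*P-expand n a b) (truncate-≈ n c)) (≈⇒≈[]
    (≈-trans (*P-distribʳ-ΣP U (λ i → ΣP U (λ j → mono (a i ⊛ b j) (i + j))) (truncate n c))
      (ΣP-cong U (λ i → ≈-trans (*P-distribʳ-ΣP U (λ j → mono (a i ⊛ b j) (i + j)) (truncate n c))
        (ΣP-cong U (λ j → mono-*-monoSum U (a i ⊛ b j) (i + j) c (λ k → k)))))))

  bcTerm : ℕ → PS
  bcTerm j = ΣP U (λ k → mono (b j ⊛ c k) (j + k))

  right : (a *P (b *P c)) ≈[ n ] expansion
  right = ≈[]-trans (*P-cong≤ (truncate-≈ n a) (*P-expand n b c)) (≈⇒≈[]
    (≈-trans (*P-distribʳ-ΣP U (λ i → mono (a i) i) (ΣP U bcTerm))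
      (ΣP-cong U (λ i → ≈-trans (*P-distribˡ-ΣP U bcTerm (mono (a i) i))
        (ΣP-cong U (λ j → ≈-trans (mono-*-monoSum U (a i) i (λ k → b j ⊛ c k) (λ k → j + k))
          (ΣP-cong U (λ k → mono-cong (sym (ℤP.*-assoc (a i) (b j) (c k))) (sym (ℕP.+-assoc i j k))))))))))

*P-interchange : ∀ a b c d → ((a *P b) *P (c *P d)) ≈ ((a *P c) *P (b *P d))
*P-interchange a b c d = begin
  (a *P b) *P (c *P d)  ≈⟨ *P-assoc a b (c *P d) ⟩
  a *P (b *P (c *P d))  ≈⟨ *P-cong (≈-refl {a}) (*P-assoc b c d) ⟨
  a *P ((b *P c) *P d)  ≈⟨ *P-cong (≈-refl {a}) (*P-cong (*P-comm b c) (≈-refl {d})) ⟩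
  a *P ((c *P b) *P d)  ≈⟨ *P-cong (≈-refl {a}) (*P-assoc c b d) ⟩
  a *P (c *P (b *P d))  ≈⟨ *P-assoc a c (b *P d) ⟨
  (a *P c) *P (b *P d)  ∎
  where open ≈-Reasoning

oneMinus-*P : ∀ e a → (oneMinus e *P a) ≈ (a -P (qpow e *P a))
oneMinus-*P e a = begin
  oneMinus e *P a               ≈⟨ *P-comm (oneMinus e) a ⟩
  a *P oneMinus e               ≈⟨ *P-distrib-P a oneP (qpow e) ⟩
  (a *P oneP) -P (a *P qpow e)  ≈⟨ -P-cong (*P-identityʳ a) (*P-comm a (qpow e)) ⟩
  a -P (qpow e *P a)            ∎
  where open ≈-Reasoning

invRev-coeffs : ∀ a m → invRev a m ≡ map (λ i → invP a (m ∸ i)) (upTo (suc m))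
invRev-coeffs a zero    = refl
invRev-coeffs a (suc m) =
  cong (invP a (suc m) ∷_)
    (trans (invRev-coeffs a m)
      (trans (ListP.map-upTo (λ i → invP a (m ∸ i)) (suc m))
             (sym (ListP.map-applyUpTo suc (λ i → invP a (suc m ∸ i)) (suc m)))))

zipWith-*-map : ∀ {A : Set} (L : List A) (f g : A → ℤ) →
  zipWith _⊛_ (map f L) (map g L) ≡ map (λ x → f x ⊛ g x) L
zipWith-*-map []      f g = refl
zipWith-*-map (x ∷ L) f g = cong (f x ⊛ g x ∷_) (zipWith-*-map L f g)

-- The recursion defining invP says exactly that a · invP a = 1.
invP-inverse : ∀ a → a 0 ≡ 1ℤ → (a *P invP a) ≈ oneP
invP-inverse a a₀≡1 zero rewrite a₀≡1 = refl
invP-inverse a a₀≡1 (suc m) =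
  trans (sum-upTo-suc (suc m) (λ i → a i ⊛ invP a (suc m ∸ i)))
    (trans (cong₂ (λ u v → u ⊛ (- v) ⊕ rest) a₀≡1
             (cong sumℤ (trans (cong (zipWith _⊛_ (map (λ i → a (suc i)) (upTo (suc m)))) (invRev-coeffs a m))
                               (zipWith-*-map (upTo (suc m)) (λ i → a (suc i)) (λ i → invP a (m ∸ i))))))
           (trans (cong (_⊕ rest) (ℤP.*-identityˡ (- rest))) (ℤP.+-inverseˡ rest)))
  where
  rest : ℤ
  rest = sumOver (upTo (suc m)) (λ i → a (suc i) ⊛ invP a (m ∸ i))

invRev-cong : ∀ {a b} → a ≈ b → ∀ m → invRev a m ≡ invRev b m
invRev-cong a≈b zero    = refl
invRev-cong a≈b (suc m) = cong₂ (λ u v → (- sumℤ (zipWith _⊛_ u v)) ∷ v)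
  (ListP.map-cong (λ i → a≈b (suc i)) (upTo (suc m))) (invRev-cong a≈b m)

invP-cong : ∀ {a b} → a ≈ b → invP a ≈ invP b
invP-cong a≈b m = cong headℤ (invRev-cong a≈b m)

invP-unique : ∀ {m} a G → a 0 ≡ 1ℤ → (a *P G) ≈[ m ] oneP → G ≈[ m ] invP a
invP-unique a G a₀≡1 aG≈1 =
  ≈[]-trans (≈⇒≈[] G≈G[a·a⁻¹])
    (≈[]-trans (*P-cong≤ aG≈1 (≈⇒≈[] (≈-refl {invP a}))) (≈⇒≈[] (*P-identityˡ (invP a))))
  where
  open ≈-Reasoning
  G≈G[a·a⁻¹] : G ≈ ((a *P G) *P invP a)
  G≈G[a·a⁻¹] = begin
    G                      ≈⟨ *P-identityʳ G ⟨
    G *P oneP              ≈⟨ *P-cong (≈-refl {G}) (invP-inverse a a₀≡1) ⟨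
    G *P (a *P invP a)     ≈⟨ *P-assoc G a (invP a) ⟨
    (G *P a) *P invP a     ≈⟨ *P-cong (*P-comm G a) (≈-refl {invP a}) ⟩
    (a *P G) *P invP a     ∎

prodP-cong : ∀ L {f g : ℕ → PS} → (∀ j → f j ≈ g j) → prodP L f ≈ prodP L g
prodP-cong zero    f≈g = ≈-refl
prodP-cong (suc L) f≈g = *P-cong (prodP-cong L f≈g) (f≈g L)

prodP-first : ∀ L (f : ℕ → PS) → prodP (suc L) f ≈ (f 0 *P prodP L (f ∘ suc))
prodP-first zero    f = ≈-trans (*P-identityˡ (f 0)) (≈-sym (*P-identityʳ (f 0)))
prodP-first (suc L) f =
  ≈-trans (*P-cong (prodP-first L f) (≈-refl {f (suc L)})) (*P-assoc (f 0) (prodP L (f ∘ suc)) (f (suc L)))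

prodP-constant-term : ∀ L (f : ℕ → PS) → (∀ j → f j 0 ≡ 1ℤ) → prodP L f 0 ≡ 1ℤ
prodP-constant-term zero    f f₀≡1 = refl
prodP-constant-term (suc L) f f₀≡1 rewrite prodP-constant-term L f f₀≡1 | f₀≡1 L = refl

powP-qpow : ∀ c j → powP (qpow c) j ≈ qpow (c * j)
powP-qpow c zero    = ≈-trans oneP≈mono (mono-cong refl (sym (ℕP.*-zeroʳ c)))
powP-qpow c (suc j) =
  ≈-trans (*P-cong (≈-refl {qpow c}) (powP-qpow c j))
          (≈-trans (mono-mul 1ℤ 1ℤ c (c * j)) (mono-cong refl (sym (ℕP.*-suc c j))))

poch-qpow : ∀ s c L → poch (qpow s) (qpow c) L ≈ prodP L (λ j → oneMinus (s + c * j))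
poch-qpow s c L = prodP-cong L (λ j → -P-cong (≈-refl {oneP})
  (≈-trans (*P-cong (≈-refl {qpow s}) (powP-qpow c j)) (mono-mul 1ℤ 1ℤ s (c * j))))

-- Sums over multiplicity vectors.  A vector p of length L describes the
-- partition with p_i copies of the part s+i (sizeFrom s p is its size).

ΣP-vecs-cons : ∀ b L (F : Vec ℕ (suc L) → PS) →
  ΣP (vecsUpTo b (suc L)) F ≈ ΣP (upTo (suc b)) (λ x → ΣP (vecsUpTo b L) (λ p → F (x ∷ p)))
ΣP-vecs-cons b L F n =
  trans (sumOver-concatMap (upTo (suc b)) (λ x → map (x ∷_) (vecsUpTo b L)) (λ p → F p n))
        (sumOver-cong (upTo (suc b)) (λ x → sumOver-map (vecsUpTo b L) (x ∷_) (λ p → F p n)))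

ΣP-vecs-nil : ∀ b (F : Vec ℕ 0 → PS) → ΣP (vecsUpTo b 0) F ≈ F []
ΣP-vecs-nil b F n = ℤP.+-identityʳ (F [] n)

ΣP-upTo-first : ∀ b (G : ℕ → PS) → (∀ x → G (suc x) ≈ zeroP) → ΣP (upTo (suc b)) G ≈ G 0
ΣP-upTo-first b G G≈0 n =
  trans (sum-upTo-suc b (λ x → G x n))
        (trans (cong (G 0 n ⊕_) (ΣP-zero (upTo b) G≈0 n)) (ℤP.+-identityʳ (G 0 n)))

ΣP-upTo-firstTwo : ∀ b (G : ℕ → PS) → (∀ x → G (suc (suc x)) ≈ zeroP) →
  ΣP (upTo (suc (suc b))) G ≈ (G 0 +P G 1)
ΣP-upTo-firstTwo b G G≈0 n =
  trans (sum-upTo-suc (suc b) (λ x → G x n)) (cong (G 0 n ⊕_) (ΣP-upTo-first b (G ∘ suc) G≈0 n))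

+P-cong : ∀ {a a' b b'} → a ≈ a' → b ≈ b' → (a +P b) ≈ (a' +P b')
+P-cong ea eb n = cong₂ _⊕_ (ea n) (eb n)

ΣP-neg-scaled : ∀ {A : Set} (L : List A) (a : PS) (F : A → PS) →
  ΣP L (λ x → negP (a *P F x)) ≈ negP (a *P ΣP L F)
ΣP-neg-scaled L a F =
  ≈-trans (λ n → sumOver-neg L (λ x → (a *P F x) n)) (negP-cong (≈-sym (*P-distribˡ-ΣP L F a)))

ifP : Bool → PS → PS
ifP true  a = a
ifP false _ = zeroP

ifP-cong : ∀ {d d'} a → d ≡ d' → ifP d a ≈ ifP d' a
ifP-cong a refl = ≈-refl

distinctTerm : ∀ {L} → ℕ → Vec ℕ L → PS
distinctTerm s p = ifP (isDistinct p) (mono (sgn (nparts p)) (sizeFrom s p))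

distinctGF : ℕ → ℕ → ℕ → PS
distinctGF b s L = ΣP (vecsUpTo b L) (distinctTerm s)

-- The part s either is absent, or occurs once, costing a sign and a factor q^s.
distinctTerm-absent : ∀ {L} s (p : Vec ℕ L) → distinctTerm s (0 ∷ p) ≈ distinctTerm (suc s) p
distinctTerm-absent s p rewrite ℕP.*-zeroʳ s = ≈-refl

distinctTerm-once : ∀ {L} s (p : Vec ℕ L) → distinctTerm s (1 ∷ p) ≈ negP (qpow s *P distinctTerm (suc s) p)
distinctTerm-once s p with isDistinct p
... | true  = begin
  mono (- c) (s * 1 + z)       ≈⟨ mono-cong refl (cong (_+ z) (ℕP.*-identityʳ s)) ⟩
  mono (- c) (s + z)           ≈⟨ mono-neg c (s + z) ⟩
  negP (mono c (s + z))        ≈⟨ negP-cong (≈-trans (mono-mul 1ℤ c s z)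
                                                      (mono-cong {a = s + z} (ℤP.*-identityˡ c) refl)) ⟨
  negP (qpow s *P mono c z)    ∎
  where
  open ≈-Reasoning
  c = sgn (nparts p)
  z = sizeFrom (suc s) p
... | false = λ n → sym (cong -_ (*P-zeroʳ (qpow s) n))

distinctGF-step : ∀ b s L → distinctGF (suc b) s (suc L) ≈ (oneMinus s *P distinctGF (suc b) (suc s) L)
distinctGF-step b s L = begin
  distinctGF (suc b) s (suc L)         ≈⟨ ΣP-vecs-cons (suc b) L (distinctTerm s) ⟩
  ΣP (upTo (suc (suc b))) byFirst      ≈⟨ ΣP-upTo-firstTwo b byFirst (λ x → ΣP-zero V (λ p → ≈-refl)) ⟩
  byFirst 0 +P byFirst 1               ≈⟨ +P-cong (ΣP-cong V (distinctTerm-absent s))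
                                                  (ΣP-cong V (distinctTerm-once s)) ⟩
  D +P ΣP V (λ p → negP (qpow s *P distinctTerm (suc s) p))
                                       ≈⟨ +P-cong (≈-refl {D}) (ΣP-neg-scaled V (qpow s) (distinctTerm (suc s))) ⟩
  D -P (qpow s *P D)                   ≈⟨ oneMinus-*P s D ⟨
  oneMinus s *P D                      ∎
  where
  open ≈-Reasoning
  V = vecsUpTo (suc b) L
  D = distinctGF (suc b) (suc s) L
  byFirst : ℕ → PS
  byFirst x = ΣP V (λ p → distinctTerm s (x ∷ p))

distinctGF-prod : ∀ b L s → distinctGF (suc b) s L ≈ prodP L (λ j → oneMinus (s + j))
distinctGF-prod b zero    s = ≈-trans (ΣP-vecs-nil (suc b) (distinctTerm s)) (≈-sym oneP≈mono)
distinctGF-prod b (suc L) s = begin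
  distinctGF (suc b) s (suc L)                     ≈⟨ distinctGF-step b s L ⟩
  oneMinus s *P distinctGF (suc b) (suc s) L       ≈⟨ *P-cong (≈-refl {oneMinus s}) (distinctGF-prod b L (suc s)) ⟩
  oneMinus s *P prodP L (λ j → oneMinus (suc s + j)) ≈⟨ *P-cong (oneMinus-cong (sym (ℕP.+-identityʳ s)))
                                                            (prodP-cong L (λ j → oneMinus-cong (sym (ℕP.+-suc s j)))) ⟩
  oneMinus (s + 0) *P prodP L (λ j → oneMinus (s + suc j))  ≈⟨ prodP-first L (λ j → oneMinus (s + j)) ⟨
  prodP (suc L) (λ j → oneMinus (s + j))           ∎
  where open ≈-Reasoning

doubledTerm : ∀ {L} → ℕ → Vec ℕ L → PS
doubledTerm s p = qpow (sizeFrom s p + sizeFrom s p)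

doubledGF : ℕ → ℕ → ℕ → PS
doubledGF b s L = ΣP (vecsUpTo b L) (doubledTerm s)

-- Σ_{y≤b} q^{2sy}: the choices of the multiplicity y of the part s.
geometric : ℕ → ℕ → PS
geometric b s = ΣP (upTo (suc b)) (λ y → qpow (s * y + s * y))

doubledGF-step : ∀ b s L → doubledGF b s (suc L) ≈ (geometric b s *P doubledGF b (suc s) L)
doubledGF-step b s L =
  ≈-trans (ΣP-vecs-cons b L (doubledTerm s)) (≈-sym
    (≈-trans (monoSum-*-monoSum U V (λ _ → 1ℤ) (λ y → s * y + s * y)
                                    (λ _ → 1ℤ) (λ p → sizeFrom (suc s) p + sizeFrom (suc s) p))
             (ΣP-cong U (λ y → ΣP-cong V (λ p → mono-cong refl (regroup (s * y) (sizeFrom (suc s) p)))))))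
  where
  U = upTo (suc b)
  V = vecsUpTo b L
  regroup : ∀ u z → (u + u) + (z + z) ≡ (u + z) + (u + z)
  regroup = ℕSolver.solve-∀

-- (1 - q^{2s}) Σ_{y≤b} q^{2sy} = 1 - q^{2s(b+1)}, which is 1 in degrees ≤ b as s ≥ 1.
geometric-inverse : ∀ b s → (oneMinus (2 * suc s) *P geometric b (suc s)) ≈[ b ] oneP
geometric-inverse b s n n≤b = begin
  (oneMinus e *P geometric b (suc s)) n         ≡⟨ *P-distribˡ-ΣP U F (oneMinus e) n ⟩
  ΣP U (λ y → oneMinus e *P F y) n              ≡⟨ ΣP-cong U shift n ⟩
  sumOver U (λ y → F y n ⊖ F (suc y) n)         ≡⟨ sum-upTo-telescope (suc b) (λ y → F y n) ⟩
  F 0 n ⊖ F (suc b) n                           ≡⟨ cong₂ _⊖_ (trans (mono-cong refl (vanishing (suc s)) n) (sym (oneP≈mono n)))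
                                                              (mono-miss 1ℤ (exponent (suc b)) n beyond) ⟩
  oneP n ⊖ 0ℤ                                   ≡⟨ ℤP.+-identityʳ (oneP n) ⟩
  oneP n                                        ∎
  where
  open ≡-Reasoning
  e = 2 * suc s
  U = upTo (suc b)
  exponent : ℕ → ℕ
  exponent y = suc s * y + suc s * y
  F : ℕ → PS
  F y = qpow (exponent y)
  step : ∀ s y → s * y + s * y + 2 * s ≡ s * suc y + s * suc y
  step = ℕSolver.solve-∀
  shift : ∀ y → (oneMinus e *P F y) ≈ (F y -P F (suc y))
  shift y = ≈-trans (oneMinus-*P e (F y))
    (-P-cong (≈-refl {F y}) (≈-trans (*P-comm (qpow e) (F y))
                             (≈-trans (mono-mul 1ℤ 1ℤ (exponent y) e) (mono-cong refl (step (suc s) y)))))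
  vanishing : ∀ s → s * 0 + s * 0 ≡ 0
  vanishing s rewrite ℕP.*-zeroʳ s = refl
  beyond : exponent (suc b) ≢ n
  beyond e≡n = ℕP.<-irrefl (sym e≡n)
    (ℕP.≤-trans (s≤s n≤b) (ℕP.≤-trans (ℕP.m≤n*m (suc b) (suc s)) (ℕP.m≤m+n _ _)))

doubledGF-inverse : ∀ b L s → (prodP L (λ j → oneMinus (2 * suc s + 2 * j)) *P doubledGF b (suc s) L) ≈[ b ] oneP
doubledGF-inverse b zero    s =
  ≈⇒≈[] (≈-trans (*P-identityˡ (doubledGF b (suc s) 0))
                 (≈-trans (ΣP-vecs-nil b (doubledTerm (suc s))) (≈-sym oneP≈mono)))
doubledGF-inverse b (suc L) s =
  ≈[]-trans (≈⇒≈[] regrouped)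
    (≈[]-trans (*P-cong≤ (geometric-inverse b s) (doubledGF-inverse b L (suc s))) (≈⇒≈[] (*P-identityˡ oneP)))
  where
  open ≈-Reasoning
  F : ℕ → PS
  F j = oneMinus (2 * suc s + 2 * j)
  P = prodP L (λ j → oneMinus (2 * suc (suc s) + 2 * j))
  first : ∀ s → 2 * s + 2 * 0 ≡ 2 * s
  first = ℕSolver.solve-∀
  shifted : ∀ s j → 2 * s + 2 * suc j ≡ 2 * suc s + 2 * j
  shifted = ℕSolver.solve-∀
  regrouped : (prodP (suc L) F *P doubledGF b (suc s) (suc L))
                ≈ ((oneMinus (2 * suc s) *P geometric b (suc s)) *P (P *P doubledGF b (suc (suc s)) L))
  regrouped = begin
    prodP (suc L) F *P doubledGF b (suc s) (suc L)
      ≈⟨ *P-cong (≈-trans (prodP-first L F)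
                   (*P-cong (oneMinus-cong (first (suc s))) (prodP-cong L (λ j → oneMinus-cong (shifted (suc s) j)))))
                 (doubledGF-step b (suc s) L) ⟩
    (oneMinus (2 * suc s) *P P) *P (geometric b (suc s) *P doubledGF b (suc (suc s)) L)
      ≈⟨ *P-interchange (oneMinus (2 * suc s)) P (geometric b (suc s)) (doubledGF b (suc (suc s)) L) ⟩
    (oneMinus (2 * suc s) *P geometric b (suc s)) *P (P *P doubledGF b (suc (suc s)) L) ∎

inS-from : ∀ {L} → ℕ → Vec ℕ L → Vec ℕ L → Bool
inS-from s p₁ p₂ = isDistinct p₁ ∧ isNonempty p₁
                 ∧ (smallestFrom s p₁ ≤∞ min∞ (smallestFrom s p₂) (smallestFrom s p₂))

tripleTerm : ∀ {L} → ℕ → Vec ℕ L → Vec ℕ L → PS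
tripleTerm s p₁ p₂ =
  ifP (inS-from s p₁ p₂) (mono (sgn (nparts p₁ ∸ 1)) (sizeFrom s p₁ + sizeFrom s p₂ + sizeFrom s p₂))

tripleGF : ℕ → ℕ → ℕ → PS
tripleGF b s L = ΣP (vecsUpTo b L) (λ p₁ → ΣP (vecsUpTo b L) (tripleTerm s p₁))

≤ᵇ-false : ∀ k s → s < k → (k ≤ᵇ s) ≡ false
≤ᵇ-false k s s<k with k ≤ᵇ s in k≤ᵇs
... | true  = ⊥-elim (ℕP.<⇒≱ s<k (ℕP.≤ᵇ⇒≤ k s (subst T (sym k≤ᵇs) tt)))
... | false = refl

smallest-above : ∀ {L} k (p : Vec ℕ L) s → s < k → (smallestFrom k p ≤∞ just s) ≡ false
smallest-above k []          s s<k = refl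
smallest-above k (zero  ∷ p) s s<k = smallest-above (suc k) p s (ℕP.m<n⇒m<1+n s<k)
smallest-above k (suc _ ∷ p) s s<k = ≤ᵇ-false k s s<k

smallest-atLeast : ∀ {L} k (p : Vec ℕ L) s → s ≤ k →
  (just s ≤∞ min∞ (smallestFrom k p) (smallestFrom k p)) ≡ true
smallest-atLeast k []          s s≤k = refl
smallest-atLeast k (zero  ∷ p) s s≤k = smallest-atLeast (suc k) p s (ℕP.m≤n⇒m≤1+n s≤k)
smallest-atLeast k (suc _ ∷ p) s s≤k rewrite ℕP.⊓-idem k = Equivalence.to BoolP.T-≡ (ℕP.≤⇒≤ᵇ s≤k)

tripleTerm-neither : ∀ {L} s (p₁ p₂ : Vec ℕ L) → tripleTerm s (0 ∷ p₁) (0 ∷ p₂) ≈ tripleTerm (suc s) p₁ p₂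
tripleTerm-neither s p₁ p₂ rewrite ℕP.*-zeroʳ s = ≈-refl

-- If π₂ contains s but π₁ does not, then s(π₁) > s(π₂): the triple is not in S_N.
tripleTerm-onlySecond : ∀ {L} s y (p₁ p₂ : Vec ℕ L) → tripleTerm s (0 ∷ p₁) (suc y ∷ p₂) ≈ zeroP
tripleTerm-onlySecond s y p₁ p₂ = ifP-cong _ notIn
  where
  notIn : inS-from s (0 ∷ p₁) (suc y ∷ p₂) ≡ false
  notIn rewrite ℕP.⊓-idem s | smallest-above (suc s) p₁ s ℕP.≤-refl
    = trans (cong (isDistinct p₁ ∧_) (BoolP.∧-zeroʳ (isNonempty p₁))) (BoolP.∧-zeroʳ (isDistinct p₁))

-- If π₁ contains s, it is the smallest part of the triple, and the term factors
-- as q^s times a distinct-part term for parts > s times a doubled term.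
tripleTerm-firstContains : ∀ {L} s (p₁ : Vec ℕ L) (p₂ : Vec ℕ (suc L)) →
  ((qpow s *P distinctTerm (suc s) p₁) *P doubledTerm s p₂) ≈ tripleTerm s (1 ∷ p₁) p₂
tripleTerm-firstContains s p₁ p₂ = ≈-trans (factor (isDistinct p₁)) (ifP-cong _ (sym contains))
  where
  c = sgn (nparts p₁)
  z₁ = sizeFrom (suc s) p₁
  z₂ = sizeFrom s p₂
  contains : inS-from s (1 ∷ p₁) p₂ ≡ isDistinct p₁
  contains rewrite smallest-atLeast s p₂ s ℕP.≤-refl = BoolP.∧-identityʳ (isDistinct p₁)
  regroup : ∀ s z₁ z₂ → (s + z₁) + (z₂ + z₂) ≡ (s * 1 + z₁) + z₂ + z₂
  regroup = ℕSolver.solve-∀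
  factor : ∀ d → ((qpow s *P ifP d (mono c z₁)) *P qpow (z₂ + z₂)) ≈ ifP d (mono c ((s * 1 + z₁) + z₂ + z₂))
  factor true  =
    ≈-trans (*P-cong (mono-mul 1ℤ c s z₁) (≈-refl {qpow (z₂ + z₂)}))
      (≈-trans (mono-mul (1ℤ ⊛ c) 1ℤ (s + z₁) (z₂ + z₂))
               (mono-cong (trans (ℤP.*-identityʳ (1ℤ ⊛ c)) (ℤP.*-identityˡ c)) (regroup s z₁ z₂)))
  factor false = ≈-trans (*P-cong (*P-zeroʳ (qpow s)) (≈-refl {qpow (z₂ + z₂)})) (*P-zeroˡ (qpow (z₂ + z₂)))

-- Triples whose π₁ lacks the part s: then π₂ lacks it too.
tripleGF-firstAbsent : ∀ b s L (p₁ : Vec ℕ L) →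
  ΣP (vecsUpTo b (suc L)) (tripleTerm s (0 ∷ p₁)) ≈ ΣP (vecsUpTo b L) (tripleTerm (suc s) p₁)
tripleGF-firstAbsent b s L p₁ = begin
  ΣP (vecsUpTo b (suc L)) (tripleTerm s (0 ∷ p₁))       ≈⟨ ΣP-vecs-cons b L (tripleTerm s (0 ∷ p₁)) ⟩
  ΣP (upTo (suc b)) byFirst                             ≈⟨ ΣP-upTo-first b byFirst
                                                             (λ y → ΣP-zero V (tripleTerm-onlySecond s y p₁)) ⟩
  byFirst 0                                             ≈⟨ ΣP-cong V (tripleTerm-neither s p₁) ⟩
  ΣP V (tripleTerm (suc s) p₁)                          ∎
  where
  open ≈-Reasoning
  V = vecsUpTo b L
  byFirst : ℕ → PS
  byFirst y = ΣP V (λ p₂ → tripleTerm s (0 ∷ p₁) (y ∷ p₂))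

tripleGF-firstContains : ∀ b s L →
  ΣP (vecsUpTo b L) (λ p₁ → ΣP (vecsUpTo b (suc L)) (tripleTerm s (1 ∷ p₁)))
    ≈ ((qpow s *P distinctGF b (suc s) L) *P doubledGF b s (suc L))
tripleGF-firstContains b s L = ≈-sym (begin
  (qpow s *P distinctGF b (suc s) L) *P doubledGF b s (suc L)
    ≈⟨ *P-cong (*P-distribˡ-ΣP V (distinctTerm (suc s)) (qpow s)) (≈-refl {doubledGF b s (suc L)}) ⟩
  ΣP V (λ p₁ → qpow s *P distinctTerm (suc s) p₁) *P doubledGF b s (suc L)
    ≈⟨ *P-distribʳ-ΣP V (λ p₁ → qpow s *P distinctTerm (suc s) p₁) (doubledGF b s (suc L)) ⟩
  ΣP V (λ p₁ → (qpow s *P distinctTerm (suc s) p₁) *P doubledGF b s (suc L))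
    ≈⟨ ΣP-cong V (λ p₁ → ≈-trans (*P-distribˡ-ΣP W (doubledTerm s) (qpow s *P distinctTerm (suc s) p₁))
                                  (ΣP-cong W (tripleTerm-firstContains s p₁))) ⟩
  ΣP V (λ p₁ → ΣP W (tripleTerm s (1 ∷ p₁)))  ∎)
  where
  open ≈-Reasoning
  V = vecsUpTo b L
  W = vecsUpTo b (suc L)

-- Removing the part s: either π₁ lacks it, or s is the smallest part of π₁.
tripleGF-step : ∀ b s L → tripleGF (suc b) s (suc L)
  ≈ (tripleGF (suc b) (suc s) L +P ((qpow s *P distinctGF (suc b) (suc s) L) *P doubledGF (suc b) s (suc L)))
tripleGF-step b s L = begin
  tripleGF (suc b) s (suc L)           ≈⟨ ΣP-vecs-cons (suc b) L second ⟩
  ΣP (upTo (suc (suc b))) byFirst      ≈⟨ ΣP-upTo-firstTwo b byFirst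
                                            (λ x → ΣP-zero V (λ p₁ → ΣP-zero W (λ p₂ → ≈-refl))) ⟩
  byFirst 0 +P byFirst 1               ≈⟨ +P-cong (ΣP-cong V (tripleGF-firstAbsent (suc b) s L))
                                                  (tripleGF-firstContains (suc b) s L) ⟩
  tripleGF (suc b) (suc s) L +P ((qpow s *P distinctGF (suc b) (suc s) L) *P doubledGF (suc b) s (suc L)) ∎
  where
  open ≈-Reasoning
  V = vecsUpTo (suc b) L
  W = vecsUpTo (suc b) (suc L)
  second : Vec ℕ (suc L) → PS
  second p₁ = ΣP W (tripleTerm s p₁)
  byFirst : ℕ → PS
  byFirst x = ΣP V (λ p₁ → second (x ∷ p₁))

-- Contribution of the triples whose π₁ has smallest part k (parts ≤ N).
smallestPartSummand : ℕ → ℕ → ℕ → PS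
smallestPartSummand b N k = (qpow k *P distinctGF b (suc k) (N ∸ k)) *P doubledGF b k (suc (N ∸ k))

tripleGF-bySmallestPart : ∀ b N L s → s + L ≡ suc N →
  tripleGF (suc b) s L ≈ ΣP (upTo L) (λ i → smallestPartSummand (suc b) N (s + i))
tripleGF-bySmallestPart b N zero    s _      n = refl
tripleGF-bySmallestPart b N (suc L) s s+L≡N n = begin
  tripleGF (suc b) s (suc L) n
    ≡⟨ tripleGF-step b s L n ⟩
  tripleGF (suc b) (suc s) L n ⊕ summandWith L
    ≡⟨ cong₂ _⊕_ (tripleGF-bySmallestPart b N L (suc s) (trans (sym (ℕP.+-suc s L)) s+L≡N) n)
                 (cong summandWith (sym remaining)) ⟩
  ΣP (upTo L) (λ i → summand (suc s + i)) n ⊕ summand s n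
    ≡⟨ ℤP.+-comm (ΣP (upTo L) (λ i → summand (suc s + i)) n) (summand s n) ⟩
  summand s n ⊕ ΣP (upTo L) (λ i → summand (suc s + i)) n
    ≡⟨ cong₂ _⊕_ (cong (λ k → summand k n) (sym (ℕP.+-identityʳ s)))
                 (sumOver-cong (upTo L) (λ i → cong (λ k → summand k n) (sym (ℕP.+-suc s i)))) ⟩
  summand (s + 0) n ⊕ ΣP (upTo L) (λ i → summand (s + suc i)) n
    ≡⟨ sum-upTo-suc L (λ i → summand (s + i) n) ⟨
  ΣP (upTo (suc L)) (λ i → summand (s + i)) n ∎
  where
  open ≡-Reasoning
  summand : ℕ → PS
  summand = smallestPartSummand (suc b) N
  summandWith : ℕ → ℤ
  summandWith l = ((qpow s *P distinctGF (suc b) (suc s) l) *P doubledGF (suc b) s (suc l)) n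
  remaining : N ∸ s ≡ L
  remaining = trans (cong (_∸ s) (sym (ℕP.suc-injective (trans (sym (ℕP.+-suc s L)) s+L≡N)))) (ℕP.m+n∸m≡n s L)

poch-distinctGF : ∀ b N k → poch (qpow (suc k)) (qpow 1) (N ∸ k) ≈ distinctGF (suc b) (suc k) (N ∸ k)
poch-distinctGF b N k =
  ≈-trans (poch-qpow (suc k) 1 (N ∸ k))
    (≈-trans (prodP-cong (N ∸ k) (λ j → oneMinus-cong (cong (suc k +_) (ℕP.*-identityˡ j))))
             (≈-sym (distinctGF-prod b (N ∸ k) (suc k))))

invPoch-doubledGF : ∀ b L k → invP (poch (qpow (2 * suc k)) (qpow 2) L) ≈[ b ] doubledGF b (suc k) L
invPoch-doubledGF b L k = ≈[]-sym (≈[]-trans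
  (invP-unique P (doubledGF b (suc k) L) (prodP-constant-term L F (λ _ → refl)) (doubledGF-inverse b L k))
  (≈⇒≈[] (invP-cong (≈-sym (poch-qpow (2 * suc k) 2 L)))))
  where
  F : ℕ → PS
  F j = oneMinus (2 * suc k + 2 * j)
  P = prodP L F

-- The k-th summand of the left-hand side; lhs N is by definition Σ_{i<N} lhsSummand N (i+1).
lhsSummand : ℕ → ℕ → PS
lhsSummand N k =
  (qpow k *P poch (qpow (suc k)) (qpow 1) (N ∸ k)) *P invP (poch (qpow (2 * k)) (qpow 2) (suc (N ∸ k)))

lhsSummand-agrees : ∀ b N i → lhsSummand N (suc i) ≈[ suc b ] smallestPartSummand (suc b) N (suc i)
lhsSummand-agrees b N i =
  *P-cong≤ (≈⇒≈[] (*P-cong (≈-refl {qpow (suc i)}) (poch-distinctGF b N (suc i))))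
           (invPoch-doubledGF (suc b) (suc (N ∸ suc i)) i)

-- Every summand has the factor q^k with k ≥ 1.
lhs-constantTerm : ∀ N → lhs N 0 ≡ 0ℤ
lhs-constantTerm N = sumOver-zero (upTo N) {f = λ i → lhsSummand N (suc i) 0} vanishes
  where
  *P-constantTerm : ∀ a b → (a *P b) 0 ≡ a 0 ⊛ b 0
  *P-constantTerm a b = ℤP.+-identityʳ (a 0 ⊛ b 0)
  vanishes : ∀ i → lhsSummand N (suc i) 0 ≡ 0ℤ
  vanishes i = begin
    lhsSummand N (suc i) 0                    ≡⟨ *P-constantTerm (qpow (suc i) *P P) I ⟩
    (qpow (suc i) *P P) 0 ⊛ I 0               ≡⟨ cong (_⊛ I 0) (*P-constantTerm (qpow (suc i)) P) ⟩
    (0ℤ ⊛ P 0) ⊛ I 0                          ≡⟨ cong (_⊛ I 0) (ℤP.*-zeroˡ (P 0)) ⟩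
    0ℤ ⊛ I 0                                  ≡⟨ ℤP.*-zeroˡ (I 0) ⟩
    0ℤ                                        ∎
    where
    open ≡-Reasoning
    P = poch (qpow (suc (suc i))) (qpow 1) (N ∸ suc i)
    I = invP (poch (qpow (2 * suc i)) (qpow 2) (suc (N ∸ suc i)))

NSC≡tripleGF : ∀ n N → NSC n N ≡ tripleGF n 1 N n
NSC≡tripleGF n N = begin
  NSC n N
    ≡⟨ cong sumℤ (ListP.map-id (concatMap (λ p₁ → map (weight p₁) V) V)) ⟨
  sumOver (concatMap (λ p₁ → map (weight p₁) V) V) (λ w → w)
    ≡⟨ sumOver-concatMap V (λ p₁ → map (weight p₁) V) (λ w → w) ⟩
  sumOver V (λ p₁ → sumOver (map (weight p₁) V) (λ w → w))
    ≡⟨ sumOver-cong V (λ p₁ → sumOver-map V (weight p₁) (λ w → w)) ⟩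
  sumOver V (λ p₁ → sumOver V (weight p₁))
    ≡⟨ sumOver-cong V (λ p₁ → sumOver-cong V (λ p₂ →
         ifThen-coefficient (inS p₁ p₂ p₂) (tripleSize p₁ p₂ p₂) (sgn (nparts p₁ ∸ 1)))) ⟩
  tripleGF n 1 N n ∎
  where
  open ≡-Reasoning
  V = vecsUpTo n N
  weight : Vec ℕ N → Vec ℕ N → ℤ
  weight p₁ p₂ = if inS p₁ p₂ p₂ ∧ (tripleSize p₁ p₂ p₂ ≡ᵇ n) then sgn (nparts p₁ ∸ 1) else 0ℤ
  ifThen-coefficient : ∀ d z c → (if d ∧ (z ≡ᵇ n) then c else 0ℤ) ≡ ifP d (mono c z) n
  ifThen-coefficient true  z c = refl
  ifThen-coefficient false z c = refl

theorem6p2 : (N n : ℕ) → lhs N n ≡ rhs N n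
theorem6p2 N zero    = lhs-constantTerm N
theorem6p2 N (suc n) = begin
  lhs N (suc n)
    ≡⟨ sum-upTo-cong N (λ i _ → lhsSummand-agrees n N i (suc n) ℕP.≤-refl) ⟩
  ΣP (upTo N) (λ i → smallestPartSummand (suc n) N (suc i)) (suc n)
    ≡⟨ tripleGF-bySmallestPart n N N 1 refl (suc n) ⟨
  tripleGF (suc n) 1 N (suc n)
    ≡⟨ NSC≡tripleGF (suc n) N ⟨
  NSC (suc n) N ∎
  where open ≡-Reasoning
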